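{- Let $T(n)$ denote the telephone numbers, $T(n)=\sum_{r=0}^{\lfloor n/2\rfloor}\frac{n!}{(n-2r)!\,r!\,2^{r}}$ for $n\ge0$. Then for every integer $n\ge 0$, $$T(2n)=\sum_{r=0}^{n}\binom{n}{r}^{2}r!\,T(n-r)^{2}.$$
   Context: Equivalently $T(n)=H_n(1,\tfrac12)$ where $H_n(x,y)=n!\sum_{r=0}^{\lfloor n/2\rfloor}\frac{x^{n-2r}y^r}{(n-2r)!\,r!}$ are the two-variable Hermite–Kampé de Fériet polynomials; the exponential generating function of $T(n)$ is $e^{t+t^2/2}$. -}

module Defs where

open import Data.Nat using (ℕ; zero; suc; _+_; _*_; _∸_; _^_; _/_; NonZero; _!)
open import Data.Nat.Properties using (m*n≢0; m^n≢0; _!≢0)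
open import Data.Nat.Combinatorics using (_C_)
open import Data.List using (List; map; upTo)
open import Data.Nat.ListAction using (sum)

sumTo : ℕ → (ℕ → ℕ) → ℕ
sumTo m f = sum (map f (upTo (suc m)))

-- The r-th summand  n! / ((n-2r)! r! 2^r)  (an exact integer for 2r ≤ n;
-- ℕ-division is exact in that case).
telTerm : ℕ → ℕ → ℕ
telTerm n r = (n !) / (((n ∸ 2 * r) ! * r !) * 2 ^ r)
  where
  instance
    nz : NonZero (((n ∸ 2 * r) ! * r !) * 2 ^ r)
    nz = m*n≢0 ((n ∸ 2 * r) ! * r !) (2 ^ r)
           {{m*n≢0 ((n ∸ 2 * r) !) (r !) {{(n ∸ 2 * r) !≢0}} {{r !≢0}}}} {{m^n≢0 2 r}}

T : ℕ → ℕ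
T n = sumTo (n / 2) (telTerm n)

-- T(n) counts the involutions of an n-element set: C(n,2r)·(2r−1)!! of them have r two-cycles,
-- and this is the r-th summand n!/((n−2r)! r! 2^r).  Hence T(m+1) = T(m) + m·T(m−1): the new
-- point is either fixed or paired with one of the m others.
--
-- The theorem is the case a = b = n of the addition formula
--   T(a+b) = Σ_r r!·C(a,r)·C(b,r)·T(a−r)·T(b−r)
-- (r is the number of two-cycles joining the a-part to the b-part).  Using the recurrence of T,
-- Pascal's rule and absorption, both sides satisfy F(a,b+1) = F(a,b) + b·F(a,b−1) + a·F(a−1,b),
-- and they agree at b = 0; so the formula follows by induction on b.

module Submission where

open import Defs
open import Data.Nat
  using (ℕ; zero; suc; _+_; _*_; _∸_; _^_; _!; _/_; _≤_; _<_; z≤n; s≤s; _≤?_; NonZero)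
open import Data.Nat.Properties
open import Data.Nat.DivMod using (m*n/n≡m; m/n*n≡m; m/n*n≤m; m/n≤m; /-monoˡ-≤)
open import Data.Nat.Combinatorics
  using (_C_; nCk≡n!/k![n-k]!; k![n∸k]!∣n!; k>n⇒nCk≡0; nCk+nC[k+1]≡[n+1]C[k+1]; nC1≡n)
open import Data.Nat.Tactic.RingSolver using (solve-∀)
open import Data.List using (map; applyUpTo)
open import Data.Nat.ListAction using (sum)
open import Data.Product using (_×_; _,_; proj₂)
open import Function using (_∘_; id)
open import Relation.Binary.PropositionalEquality
open import Relation.Nullary using (yes; no)

open ≡-Reasoning

sumBelow : ℕ → (ℕ → ℕ) → ℕ
sumBelow zero    f = 0
sumBelow (suc N) f = f 0 + sumBelow N (f ∘ suc)

sum-map-applyUpTo : ∀ N (g f : ℕ → ℕ) → sum (map f (applyUpTo g N)) ≡ sumBelow N (f ∘ g)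
sum-map-applyUpTo zero    g f = refl
sum-map-applyUpTo (suc N) g f = cong (f (g 0) +_) (sum-map-applyUpTo N (g ∘ suc) f)

sumTo≡sumBelow : ∀ m f → sumTo m f ≡ sumBelow (suc m) f
sumTo≡sumBelow m f = sum-map-applyUpTo (suc m) id f

sumBelow-cong : ∀ N {f g : ℕ → ℕ} →
                (∀ i → i < N → f i ≡ g i) → sumBelow N f ≡ sumBelow N g
sumBelow-cong zero    f≡g = refl
sumBelow-cong (suc N) f≡g =
  cong₂ _+_ (f≡g 0 (s≤s z≤n)) (sumBelow-cong N (λ i i<N → f≡g (suc i) (s≤s i<N)))

sumBelow-+ : ∀ N (f g : ℕ → ℕ) → sumBelow N (λ i → f i + g i) ≡ sumBelow N f + sumBelow N g
sumBelow-+ zero    f g = refl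
sumBelow-+ (suc N) f g = begin
  f 0 + g 0 + sumBelow N (λ i → f (suc i) + g (suc i))
    ≡⟨ cong (f 0 + g 0 +_) (sumBelow-+ N (f ∘ suc) (g ∘ suc)) ⟩
  f 0 + g 0 + (sumBelow N (f ∘ suc) + sumBelow N (g ∘ suc))
    ≡⟨ +-medial (f 0) (g 0) _ _ ⟩
  f 0 + sumBelow N (f ∘ suc) + (g 0 + sumBelow N (g ∘ suc)) ∎
  where
  +-medial : ∀ a b c d → a + b + (c + d) ≡ a + c + (b + d)
  +-medial = solve-∀

*-distribˡ-sumBelow : ∀ N c (f : ℕ → ℕ) → sumBelow N (λ i → c * f i) ≡ c * sumBelow N f
*-distribˡ-sumBelow zero    c f = sym (*-zeroʳ c)
*-distribˡ-sumBelow (suc N) c f =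
  trans (cong (c * f 0 +_) (*-distribˡ-sumBelow N c (f ∘ suc))) (sym (*-distribˡ-+ c (f 0) _))

sumBelow-pad : ∀ {k N} (f : ℕ → ℕ) → k ≤ N →
               (∀ i → k ≤ i → f i ≡ 0) → sumBelow N f ≡ sumBelow k f
sumBelow-pad {N = zero}  f z≤n       vanish = refl
sumBelow-pad {N = suc N} f z≤n       vanish =
  cong₂ _+_ (vanish 0 z≤n) (sumBelow-pad {N = N} (f ∘ suc) z≤n (λ i _ → vanish (suc i) z≤n))
sumBelow-pad {suc k} {suc N} f (s≤s k≤N) vanish =
  cong (f 0 +_) (sumBelow-pad (f ∘ suc) k≤N (λ i k≤i → vanish (suc i) (s≤s k≤i)))

nCk*[k!*[n∸k]!]≡n! : ∀ {n k} → k ≤ n → (n C k) * (k ! * (n ∸ k) !) ≡ n !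
nCk*[k!*[n∸k]!]≡n! {n} {k} k≤n =
  trans (cong (_* (k ! * (n ∸ k) !)) (nCk≡n!/k![n-k]! k≤n))
        (m/n*n≡m {{k !* (n ∸ k) !≢0}} (k![n∸k]!∣n! k≤n))

[k+1]*nC[k+1]≡n*[n∸1]Ck : ∀ n k → suc k * (n C suc k) ≡ n * ((n ∸ 1) C k)
[k+1]*nC[k+1]≡n*[n∸1]Ck zero          k       = *-zeroʳ (suc k)
[k+1]*nC[k+1]≡n*[n∸1]Ck (suc zero)    zero    = refl
[k+1]*nC[k+1]≡n*[n∸1]Ck (suc zero)    (suc k) = *-zeroʳ (suc (suc k))
[k+1]*nC[k+1]≡n*[n∸1]Ck (suc (suc n)) zero    =
  trans (+-identityʳ _) (trans (nC1≡n (suc (suc n))) (sym (*-identityʳ _)))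
[k+1]*nC[k+1]≡n*[n∸1]Ck (suc (suc n)) (suc k) = begin
  suc (suc k) * (suc (suc n) C suc (suc k))
    ≡⟨ cong (suc (suc k) *_) (sym (nCk+nC[k+1]≡[n+1]C[k+1] (suc n) (suc k))) ⟩
  suc (suc k) * (x + y)
    ≡⟨ regroup (suc k) x y ⟩
  x + (suc k * x + suc (suc k) * y)
    ≡⟨ cong₂ (λ p q → x + (p + q)) ([k+1]*nC[k+1]≡n*[n∸1]Ck (suc n) k)
                                    ([k+1]*nC[k+1]≡n*[n∸1]Ck (suc n) (suc k)) ⟩
  x + (suc n * (n C k) + suc n * (n C suc k))
    ≡⟨ cong (x +_) (sym (*-distribˡ-+ (suc n) (n C k) (n C suc k))) ⟩
  x + suc n * (n C k + n C suc k)
    ≡⟨ cong (λ p → x + suc n * p) (nCk+nC[k+1]≡[n+1]C[k+1] n k) ⟩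
  suc (suc n) * x ∎
  where
  x y : ℕ
  x = suc n C suc k
  y = suc n C suc (suc k)
  regroup : ∀ k x y → suc k * (x + y) ≡ x + (k * x + suc k * y)
  regroup = solve-∀

[n∸k]*nCk≡n*[n∸1]Ck : ∀ n k → (n ∸ k) * (n C k) ≡ n * ((n ∸ 1) C k)
[n∸k]*nCk≡n*[n∸1]Ck zero    zero    = refl
[n∸k]*nCk≡n*[n∸1]Ck zero    (suc k) = refl
[n∸k]*nCk≡n*[n∸1]Ck (suc n) k = begin
  (suc n ∸ k) * c                   ≡⟨ *-distribʳ-∸ c (suc n) k ⟩
  suc n * c ∸ k * c                 ≡⟨ cong (_∸ k * c) (pascal k) ⟩
  suc n * (n C k) + k * c ∸ k * c   ≡⟨ m+n∸n≡m (suc n * (n C k)) (k * c) ⟩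
  suc n * (n C k)                   ∎
  where
  c : ℕ
  c = suc n C k
  pascal : ∀ k → suc n * (suc n C k) ≡ suc n * (n C k) + k * (suc n C k)
  pascal zero    = sym (+-identityʳ _)
  pascal (suc k) = begin
    suc n * (suc n C suc k)
      ≡⟨ cong (suc n *_) (sym (nCk+nC[k+1]≡[n+1]C[k+1] n k)) ⟩
    suc n * (n C k + n C suc k)
      ≡⟨ *-distribˡ-+ (suc n) (n C k) (n C suc k) ⟩
    suc n * (n C k) + suc n * (n C suc k)
      ≡⟨ +-comm (suc n * (n C k)) _ ⟩
    suc n * (n C suc k) + suc n * (n C k)
      ≡⟨ cong (suc n * (n C suc k) +_) (sym ([k+1]*nC[k+1]≡n*[n∸1]Ck (suc n) k)) ⟩
    suc n * (n C suc k) + suc k * (suc n C suc k) ∎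

r≤n/2⇒2r≤n : ∀ {n r} → r ≤ n / 2 → 2 * r ≤ n
r≤n/2⇒2r≤n {n} r≤n/2 =
  ≤-trans (*-monoʳ-≤ 2 r≤n/2) (subst (_≤ n) (*-comm (n / 2) 2) (m/n*n≤m n 2))

2r≤n⇒r≤n/2 : ∀ {n r} → 2 * r ≤ n → r ≤ n / 2
2r≤n⇒r≤n/2 {n} {r} 2r≤n =
  subst (_≤ n / 2) (trans (cong (_/ 2) (*-comm 2 r)) (m*n/n≡m r 2)) (/-monoˡ-≤ 2 2r≤n)

pairings : ℕ → ℕ
pairings zero    = 1
pairings (suc r) = suc (2 * r) * pairings r

pairings*r!*2^r≡[2r]! : ∀ r → pairings r * (r ! * 2 ^ r) ≡ (2 * r) !
pairings*r!*2^r≡[2r]! zero    = refl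
pairings*r!*2^r≡[2r]! (suc r) = begin
  suc (2 * r) * pairings r * (suc r * r ! * (2 * 2 ^ r))
    ≡⟨ regroup r (pairings r) (r !) (2 ^ r) ⟩
  (2 + 2 * r) * (suc (2 * r) * (pairings r * (r ! * 2 ^ r)))
    ≡⟨ cong (λ x → (2 + 2 * r) * (suc (2 * r) * x)) (pairings*r!*2^r≡[2r]! r) ⟩
  (2 + 2 * r) !
    ≡⟨ cong _! (sym (*-suc 2 r)) ⟩
  (2 * suc r) ! ∎
  where
  regroup : ∀ r p f e → suc (2 * r) * p * (suc r * f * (2 * e))
                        ≡ (2 + 2 * r) * (suc (2 * r) * (p * (f * e)))
  regroup = solve-∀

involutions : ℕ → ℕ → ℕ
involutions n r = (n C (2 * r)) * pairings r

telTerm≡involutions : ∀ {n r} → 2 * r ≤ n → telTerm n r ≡ involutions n r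
telTerm≡involutions {n} {r} 2r≤n = begin
  n ! / d                  ≡⟨ cong (_/ d) (sym factorisation) ⟩
  involutions n r * d / d  ≡⟨ m*n/n≡m (involutions n r) d ⟩
  involutions n r          ∎
  where
  d : ℕ
  d = (n ∸ 2 * r) ! * r ! * 2 ^ r
  instance
    d≢0 : NonZero d
    d≢0 = m*n≢0 _ _ {{(n ∸ 2 * r) !* r !≢0}} {{m^n≢0 2 r}}
  factorisation : involutions n r * d ≡ n !
  factorisation = begin
    (n C (2 * r)) * pairings r * d
      ≡⟨ regroup (n C (2 * r)) (pairings r) ((n ∸ 2 * r) !) (r !) (2 ^ r) ⟩
    (n C (2 * r)) * (pairings r * (r ! * 2 ^ r) * (n ∸ 2 * r) !)
      ≡⟨ cong (λ x → (n C (2 * r)) * (x * (n ∸ 2 * r) !)) (pairings*r!*2^r≡[2r]! r) ⟩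
    (n C (2 * r)) * ((2 * r) ! * (n ∸ 2 * r) !)
      ≡⟨ nCk*[k!*[n∸k]!]≡n! 2r≤n ⟩
    n ! ∎
    where
    regroup : ∀ c p g f e → c * p * (g * f * e) ≡ c * (p * (f * e) * g)
    regroup = solve-∀

involutions-vanish : ∀ {n r} → n < 2 * r → involutions n r ≡ 0
involutions-vanish {r = r} n<2r = cong (_* pairings r) (k>n⇒nCk≡0 n<2r)

involutions-suc : ∀ m r →
  involutions (suc m) (suc r) ≡ involutions m (suc r) + m * involutions (m ∸ 1) r
involutions-suc m r = begin
  (suc m C (2 * suc r)) * (suc k * p)
    ≡⟨ cong (λ j → (suc m C j) * (suc k * p)) (*-suc 2 r) ⟩
  (suc m C suc (suc k)) * (suc k * p)
    ≡⟨ cong (_* (suc k * p)) (sym (nCk+nC[k+1]≡[n+1]C[k+1] m (suc k))) ⟩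
  ((m C suc k) + (m C suc (suc k))) * (suc k * p)
    ≡⟨ regroup (m C suc k) (m C suc (suc k)) (suc k) p ⟩
  (m C suc (suc k)) * (suc k * p) + suc k * (m C suc k) * p
    ≡⟨ cong₂ (λ j q → (m C j) * (suc k * p) + q * p)
             (sym (*-suc 2 r)) ([k+1]*nC[k+1]≡n*[n∸1]Ck m k) ⟩
  (m C (2 * suc r)) * (suc k * p) + m * ((m ∸ 1) C k) * p
    ≡⟨ cong (involutions m (suc r) +_) (*-assoc m ((m ∸ 1) C k) p) ⟩
  involutions m (suc r) + m * involutions (m ∸ 1) r ∎
  where
  k p : ℕ
  k = 2 * r
  p = pairings r
  regroup : ∀ x y k p → (x + y) * (k * p) ≡ y * (k * p) + k * x * p
  regroup = solve-∀

T≡sumBelow-involutions : ∀ {n N} → n < N → T n ≡ sumBelow N (involutions n)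
T≡sumBelow-involutions {n} {N} n<N = begin
  T n
    ≡⟨ sumTo≡sumBelow (n / 2) (telTerm n) ⟩
  sumBelow (suc (n / 2)) (telTerm n)
    ≡⟨ sumBelow-cong (suc (n / 2)) (λ r r≤n/2 → telTerm≡involutions {n} {r} (within r≤n/2)) ⟩
  sumBelow (suc (n / 2)) (involutions n)
    ≡⟨ sym (sumBelow-pad (involutions n) (≤-<-trans (m/n≤m n 2) n<N) beyond) ⟩
  sumBelow N (involutions n) ∎
  where
  within : ∀ {r} → r < suc (n / 2) → 2 * r ≤ n
  within = r≤n/2⇒2r≤n ∘ ≤-pred
  beyond : ∀ r → suc (n / 2) ≤ r → involutions n r ≡ 0
  beyond r n/2<r = involutions-vanish {n} {r} (≰⇒> (<⇒≱ n/2<r ∘ 2r≤n⇒r≤n/2))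

T-suc : ∀ m → T (suc m) ≡ T m + m * T (m ∸ 1)
T-suc m = begin
  T (suc m)
    ≡⟨ T≡sumBelow-involutions (n<1+n (suc m)) ⟩
  1 + sumBelow (suc m) (involutions (suc m) ∘ suc)
    ≡⟨ cong (1 +_) (sumBelow-cong (suc m) {involutions (suc m) ∘ suc} (λ r _ → involutions-suc m r)) ⟩
  1 + sumBelow (suc m) (λ r → involutions m (suc r) + paired r)
    ≡⟨ cong (1 +_) (sumBelow-+ (suc m) (involutions m ∘ suc) paired) ⟩
  1 + (sumBelow (suc m) (involutions m ∘ suc) + sumBelow (suc m) paired)
    ≡⟨ sym (+-assoc 1 (sumBelow (suc m) (involutions m ∘ suc)) _) ⟩
  sumBelow (suc (suc m)) (involutions m) + sumBelow (suc m) paired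
    ≡⟨ cong₂ _+_ (sym (T≡sumBelow-involutions (m<n⇒m<1+n (n<1+n m))))
                 (*-distribˡ-sumBelow (suc m) m (involutions (m ∸ 1))) ⟩
  T m + m * sumBelow (suc m) (involutions (m ∸ 1))
    ≡⟨ cong (λ x → T m + m * x) (sym (T≡sumBelow-involutions (s≤s (m∸n≤m m 1)))) ⟩
  T m + m * T (m ∸ 1) ∎
  where
  paired : ℕ → ℕ
  paired r = m * involutions (m ∸ 1) r

binomT : ℕ → ℕ → ℕ
binomT b r = (b C r) * T (b ∸ r)

C*T-suc : ∀ b r → (b C r) * T (suc b ∸ r) ≡ binomT b r + b * binomT (b ∸ 1) r
C*T-suc b r with r ≤? b
... | yes r≤b = begin
  (b C r) * T (suc b ∸ r)
    ≡⟨ cong (λ m → (b C r) * T m) (+-∸-assoc 1 r≤b) ⟩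
  (b C r) * T (suc (b ∸ r))
    ≡⟨ cong ((b C r) *_) (T-suc (b ∸ r)) ⟩
  (b C r) * (T (b ∸ r) + (b ∸ r) * T (b ∸ r ∸ 1))
    ≡⟨ regroup (b C r) (T (b ∸ r)) (b ∸ r) (T (b ∸ r ∸ 1)) ⟩
  binomT b r + (b ∸ r) * (b C r) * T (b ∸ r ∸ 1)
    ≡⟨ cong₂ (λ c m → binomT b r + c * T m) ([n∸k]*nCk≡n*[n∸1]Ck b r) ∸-swap ⟩
  binomT b r + b * ((b ∸ 1) C r) * T (b ∸ 1 ∸ r)
    ≡⟨ cong (binomT b r +_) (*-assoc b ((b ∸ 1) C r) _) ⟩
  binomT b r + b * binomT (b ∸ 1) r ∎
  where
  regroup : ∀ c x d y → c * (x + d * y) ≡ c * x + d * c * y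
  regroup = solve-∀
  ∸-swap : b ∸ r ∸ 1 ≡ b ∸ 1 ∸ r
  ∸-swap = trans (∸-+-assoc b r 1) (trans (cong (b ∸_) (+-comm r 1)) (sym (∸-+-assoc b 1 r)))
... | no r≰b = begin
  (b C r) * T (suc b ∸ r)
    ≡⟨ cong (_* T (suc b ∸ r)) bCr≡0 ⟩
  0
    ≡⟨ sym (*-zeroʳ b) ⟩
  b * 0
    ≡⟨ cong₂ (λ c c′ → c * T (b ∸ r) + b * (c′ * T (b ∸ 1 ∸ r)))
             (sym bCr≡0) (sym [b∸1]Cr≡0) ⟩
  binomT b r + b * binomT (b ∸ 1) r ∎
  where
  bCr≡0 : b C r ≡ 0
  bCr≡0 = k>n⇒nCk≡0 (≰⇒> r≰b)
  [b∸1]Cr≡0 : (b ∸ 1) C r ≡ 0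
  [b∸1]Cr≡0 = k>n⇒nCk≡0 (≤-<-trans (m∸n≤m b 1) (≰⇒> r≰b))

shiftʳ : (ℕ → ℕ) → ℕ → ℕ
shiftʳ f zero    = 0
shiftʳ f (suc r) = f r

binomT-suc : ∀ b r → binomT (suc b) r ≡ binomT b r + b * binomT (b ∸ 1) r + shiftʳ (binomT b) r
binomT-suc b zero    = trans (C*T-suc b 0) (sym (+-identityʳ _))
binomT-suc b (suc j) = begin
  (suc b C suc j) * T (b ∸ j)
    ≡⟨ cong (_* T (b ∸ j)) (sym (nCk+nC[k+1]≡[n+1]C[k+1] b j)) ⟩
  ((b C j) + (b C suc j)) * T (b ∸ j)
    ≡⟨ *-distribʳ-+ (T (b ∸ j)) (b C j) (b C suc j) ⟩
  binomT b j + (b C suc j) * T (suc b ∸ suc j)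
    ≡⟨ cong (binomT b j +_) (C*T-suc b (suc j)) ⟩
  binomT b j + (binomT b (suc j) + b * binomT (b ∸ 1) (suc j))
    ≡⟨ +-comm (binomT b j) _ ⟩
  binomT b (suc j) + b * binomT (b ∸ 1) (suc j) + binomT b j ∎

[r+1]!*binomT[a,r+1]≡a*r!*binomT[a∸1,r] : ∀ a r →
  suc r ! * binomT a (suc r) ≡ a * (r ! * binomT (a ∸ 1) r)
[r+1]!*binomT[a,r+1]≡a*r!*binomT[a∸1,r] a r = begin
  suc r * r ! * ((a C suc r) * T (a ∸ suc r))
    ≡⟨ regroup (suc r) (r !) (a C suc r) (T (a ∸ suc r)) ⟩
  suc r * (a C suc r) * (r ! * T (a ∸ suc r))
    ≡⟨ cong₂ (λ c m → c * (r ! * T m))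
             ([k+1]*nC[k+1]≡n*[n∸1]Ck a r) (sym (∸-+-assoc a 1 r)) ⟩
  a * ((a ∸ 1) C r) * (r ! * T (a ∸ 1 ∸ r))
    ≡⟨ regroup′ a ((a ∸ 1) C r) (r !) (T (a ∸ 1 ∸ r)) ⟩
  a * (r ! * binomT (a ∸ 1) r) ∎
  where
  regroup : ∀ k f c t → k * f * (c * t) ≡ k * c * (f * t)
  regroup = solve-∀
  regroup′ : ∀ a c f t → a * c * (f * t) ≡ a * (f * (c * t))
  regroup′ = solve-∀

additionSum : ℕ → ℕ → ℕ
additionSum a b = sumBelow (suc a) (λ r → r ! * binomT a r * binomT b r)

sumBelow-shiftʳ : ∀ N (g f : ℕ → ℕ) →
  sumBelow (suc N) (λ r → g r * shiftʳ f r) ≡ sumBelow N (λ r → g (suc r) * f r)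
sumBelow-shiftʳ N g f = cong (_+ sumBelow N (λ r → g (suc r) * f r)) (*-zeroʳ (g 0))

additionSum-shiftʳ : ∀ a b →
  sumBelow (suc a) (λ r → r ! * binomT a r * shiftʳ (binomT b) r) ≡ a * additionSum (a ∸ 1) b
additionSum-shiftʳ zero    b = sumBelow-shiftʳ 0 (λ r → r ! * binomT 0 r) (binomT b)
additionSum-shiftʳ (suc a) b = begin
  sumBelow (suc (suc a)) (λ r → r ! * binomT (suc a) r * shiftʳ (binomT b) r)
    ≡⟨ sumBelow-shiftʳ (suc a) (λ r → r ! * binomT (suc a) r) (binomT b) ⟩
  sumBelow (suc a) (λ r → suc r ! * binomT (suc a) (suc r) * binomT b r)
    ≡⟨ sumBelow-cong (suc a) (λ r _ → absorb r) ⟩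
  sumBelow (suc a) (λ r → suc a * (r ! * binomT a r * binomT b r))
    ≡⟨ *-distribˡ-sumBelow (suc a) (suc a) (λ r → r ! * binomT a r * binomT b r) ⟩
  suc a * additionSum a b ∎
  where
  absorb : ∀ r → suc r ! * binomT (suc a) (suc r) * binomT b r ≡ suc a * (r ! * binomT a r * binomT b r)
  absorb r = trans (cong (_* binomT b r) ([r+1]!*binomT[a,r+1]≡a*r!*binomT[a∸1,r] (suc a) r))
                   (*-assoc (suc a) (r ! * binomT a r) (binomT b r))

additionSum-suc : ∀ a b →
  additionSum a (suc b) ≡ additionSum a b + b * additionSum a (b ∸ 1) + a * additionSum (a ∸ 1) b
additionSum-suc a b = begin
  sumBelow (suc a) (λ r → w r * binomT (suc b) r)
    ≡⟨ sumBelow-cong (suc a) (λ r _ → expand r) ⟩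
  sumBelow (suc a) (λ r → same r + b * smaller r + marked r)
    ≡⟨ sumBelow-+ (suc a) (λ r → same r + b * smaller r) marked ⟩
  sumBelow (suc a) (λ r → same r + b * smaller r) + sumBelow (suc a) marked
    ≡⟨ cong₂ _+_ (sumBelow-+ (suc a) same (λ r → b * smaller r)) (additionSum-shiftʳ a b) ⟩
  additionSum a b + sumBelow (suc a) (λ r → b * smaller r) + a * additionSum (a ∸ 1) b
    ≡⟨ cong (λ x → additionSum a b + x + a * additionSum (a ∸ 1) b)
            (*-distribˡ-sumBelow (suc a) b smaller) ⟩
  additionSum a b + b * additionSum a (b ∸ 1) + a * additionSum (a ∸ 1) b ∎
  where
  w same smaller marked : ℕ → ℕ
  w       r = r ! * binomT a r
  same    r = w r * binomT b r
  smaller r = w r * binomT (b ∸ 1) r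
  marked  r = w r * shiftʳ (binomT b) r
  expand : ∀ r → w r * binomT (suc b) r ≡ same r + b * smaller r + marked r
  expand r = trans (cong (w r *_) (binomT-suc b r))
                   (distrib (w r) (binomT b r) b (binomT (b ∸ 1) r) (shiftʳ (binomT b) r))
    where
    distrib : ∀ w x b y z → w * (x + b * y + z) ≡ w * x + b * (w * y) + w * z
    distrib = solve-∀

-- For m = 0 the truncated subtraction changes the argument, but the factor m makes that irrelevant.
m*f[m+k∸1]≡m*f[m∸1+k] : ∀ (f : ℕ → ℕ) m k → m * f (m + k ∸ 1) ≡ m * f (m ∸ 1 + k)
m*f[m+k∸1]≡m*f[m∸1+k] f zero    k = refl
m*f[m+k∸1]≡m*f[m∸1+k] f (suc m) k = refl

AdditionAt : ℕ → Set
AdditionAt b = ∀ a → T (a + b) ≡ additionSum a b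

T-addition-zero : AdditionAt 0
T-addition-zero a = begin
  T (a + 0)                                          ≡⟨ cong T (+-identityʳ a) ⟩
  T a                                                ≡⟨ only-r≡0 (T a) ⟩
  sumBelow 1 (λ r → r ! * binomT a r * binomT 0 r)   ≡⟨ sym (sumBelow-pad {N = suc a} _ (s≤s z≤n) vanish) ⟩
  additionSum a 0                                    ∎
  where
  only-r≡0 : ∀ t → t ≡ 1 * (1 * t) * 1 + 0
  only-r≡0 = solve-∀
  vanish : ∀ r → 1 ≤ r → r ! * binomT a r * binomT 0 r ≡ 0
  vanish (suc r) _ = *-zeroʳ (suc r ! * binomT a (suc r))

T-addition-step : ∀ b → AdditionAt (b ∸ 1) → AdditionAt b → AdditionAt (suc b)
T-addition-step b ih₋₁ ih a = begin
  T (a + suc b)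
    ≡⟨ cong T (+-suc a b) ⟩
  T (suc (a + b))
    ≡⟨ T-suc (a + b) ⟩
  T (a + b) + (a + b) * T (a + b ∸ 1)
    ≡⟨ cong (T (a + b) +_) (*-distribʳ-+ (T (a + b ∸ 1)) a b) ⟩
  T (a + b) + (a * T (a + b ∸ 1) + b * T (a + b ∸ 1))
    ≡⟨ cong₂ (λ x y → x + (y + b * T (a + b ∸ 1))) (ih a) shrink-a ⟩
  additionSum a b + (a * additionSum (a ∸ 1) b + b * T (a + b ∸ 1))
    ≡⟨ cong (λ y → additionSum a b + (a * additionSum (a ∸ 1) b + y)) shrink-b ⟩
  additionSum a b + (a * additionSum (a ∸ 1) b + b * additionSum a (b ∸ 1))
    ≡⟨ swap (additionSum a b) _ _ ⟩
  additionSum a b + b * additionSum a (b ∸ 1) + a * additionSum (a ∸ 1) b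
    ≡⟨ sym (additionSum-suc a b) ⟩
  additionSum a (suc b) ∎
  where
  shrink-a : a * T (a + b ∸ 1) ≡ a * additionSum (a ∸ 1) b
  shrink-a = trans (m*f[m+k∸1]≡m*f[m∸1+k] T a b) (cong (a *_) (ih (a ∸ 1)))
  shrink-b : b * T (a + b ∸ 1) ≡ b * additionSum a (b ∸ 1)
  shrink-b = begin
    b * T (a + b ∸ 1)    ≡⟨ cong (λ m → b * T (m ∸ 1)) (+-comm a b) ⟩
    b * T (b + a ∸ 1)    ≡⟨ m*f[m+k∸1]≡m*f[m∸1+k] T b a ⟩
    b * T (b ∸ 1 + a)    ≡⟨ cong (λ m → b * T m) (+-comm (b ∸ 1) a) ⟩
    b * T (a + (b ∸ 1))  ≡⟨ cong (b *_) (ih₋₁ a) ⟩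
    b * additionSum a (b ∸ 1) ∎
  swap : ∀ x y z → x + (y + z) ≡ x + z + y
  swap = solve-∀

T-addition : ∀ a b → T (a + b) ≡ additionSum a b
T-addition a b = proj₂ (consecutive b) a
  where
  -- the recurrence in b reaches back two steps
  consecutive : ∀ b → AdditionAt (b ∸ 1) × AdditionAt b
  consecutive zero    = T-addition-zero , T-addition-zero
  consecutive (suc b) = let (previous , current) = consecutive b in
    current , T-addition-step b previous current

mainTheorem6 : (n : ℕ) → T (2 * n) ≡ sumTo n (λ r → ((n C r) ^ 2 * r !) * T (n ∸ r) ^ 2)
mainTheorem6 n = begin
  T (2 * n)
    ≡⟨ cong (λ m → T (n + m)) (+-identityʳ n) ⟩
  T (n + n)
    ≡⟨ T-addition n n ⟩
  additionSum n n
    ≡⟨ sumBelow-cong (suc n) (λ r _ → square (n C r) (r !) (T (n ∸ r))) ⟩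
  sumBelow (suc n) (λ r → ((n C r) ^ 2 * r !) * T (n ∸ r) ^ 2)
    ≡⟨ sym (sumTo≡sumBelow n _) ⟩
  sumTo n (λ r → ((n C r) ^ 2 * r !) * T (n ∸ r) ^ 2) ∎
  where
  square : ∀ c f t → f * (c * t) * (c * t) ≡ (c * (c * 1) * f) * (t * (t * 1))
  square = solve-∀
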